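{- If $\Gamma\vdash_r M:\delta\mid\Delta$ is derivable in the restricted intersection type system defined below, for some restricted basis $\Gamma$, restricted context $\Delta$ and restricted term type $\delta$, then the $\lambda\mu$-term $M$ is strongly normalising.
   Context: Syntax. $\lambda\mu$-terms are $M::=x\mid\lambda x.M\mid MN\mid\mu\alpha.c$ and commands are $c::=[\alpha]M$. Structural substitution is defined by $([\alpha]M)[\alpha\Leftarrow L]=[\alpha](M[\alpha\Leftarrow L])L$ and homomorphically otherwise. Reduction is the compatible closure of $(\lambda x.M)N\to M[N/x]$ and $(\mu\alpha.c)N\to\mu\alpha.c[\alpha\Leftarrow N]$. $M$ is strongly normalising if there is no infinite reduction sequence starting from $M$. Restricted types. With a single type constant $\psi$: term types $\delta::=\kappa\to\psi\mid\delta\wedge\delta$ and continuation types $\kappa::=\omega\mid\delta\times\kappa\mid\kappa\wedge\kappa$. The preorders $\le^r_D,\le^r_C$ are the least preorders such that: - $\wedge$ is a meet in each sort ($\sigma\wedge\tau\le\sigma$, $\sigma\wedge\tau\le\tau$, and $\sigma\le\tau_1,\sigma\le\tau_2\Rightarrow\sigma\le\tau_1\wedge\tau_2$); - $\kappa\le^r_C\omega$; - $(\delta_1\times\kappa_1)\wedge(\delta_2\times\kappa_2)\le^r_C(\delta_1\wedge\delta_2)\times(\kappa_1\wedge\kappa_2)$; - $\delta_1\le^r_D\delta_2$ and $\kappa_1\le^r_C\kappa_2$ imply $\delta_1\times\kappa_1\le^r_C\delta_2\times\kappa_2$; - $\kappa_2\le^r_C\kappa_1$ implies $\kappa_1\to\psi\le^r_D\kappa_2\to\psi$.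 Restricted system. A restricted basis $\Gamma$ is a finite map from variables to restricted term types; a restricted context $\Delta$ is a finite map from names to restricted continuation types, with $\Delta(\alpha)=\omega$ if $\alpha\notin\mathrm{dom}\,\Delta$. Rules: - (Ax) $\Gamma,x{:}\delta\vdash_r x:\delta\mid\Delta$; - ($\lambda$) from $\Gamma,x{:}\delta\vdash_r M:\kappa\to\psi\mid\Delta$ infer $\Gamma\vdash_r\lambda x.M:(\delta\times\kappa)\to\psi\mid\Delta$; - (App) from $\Gamma\vdash_r M:(\delta\times\kappa)\to\psi\mid\Delta$ and $\Gamma\vdash_r N:\delta\mid\Delta$ infer $\Gamma\vdash_r MN:\kappa\to\psi\mid\Delta$; - (cmd) from $\Gamma\vdash_r M:\delta\mid\Delta$ infer $\Gamma\vdash_r[\alpha]M:\delta\times\Delta(\alpha)\mid\Delta$; - ($\mu$) from $\Gamma\vdash_r c:(\kappa'\to\psi)\times\kappa'\mid\Delta$ infer $\Gamma\vdash_r\mu\alpha.c:\Delta(\alpha)\to\psi\mid\Delta\setminus\alpha$; - ($\wedge$) from types $\sigma$ and $\tau$ for $T$ infer $\sigma\wedge\tau$; - ($\le$) subsumption along $\le^r$. There is no rule assigning $\omega$. -}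

module Defs where

open import Data.Nat using (ℕ; zero; suc; _≟_)
open import Data.List using (List; []; _∷_)
open import Data.Maybe using (Maybe; just; nothing)
open import Data.Product using (Σ; _×_)
open import Function using (id)
open import Relation.Nullary using (¬_; yes; no)
open import Relation.Binary.PropositionalEquality using (_≡_)

-- λμ-syntax, locally nameless in the de Bruijn style:
-- term variables and names (μ-variables) are two separate index spaces.
--   var x      : term variable with de Bruijn index x
--   lam M      : λ binds term variable 0 in M
--   app M N    : application
--   mu c       : μ binds name 0 in the command c
--   named α M  : the command [α]M

mutual
  data Term : Set where
    var : ℕ → Term
    lam : Term → Term
    app : Term → Term → Term
    mu  : Cmd → Term

  data Cmd : Set where
    named : ℕ → Term → Cmd

ext : (ℕ → ℕ) → ℕ → ℕ
ext ρ zero    = zero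
ext ρ (suc n) = suc (ρ n)

mutual
  renT : (ℕ → ℕ) → (ℕ → ℕ) → Term → Term
  renT ρ θ (var x)   = var (ρ x)
  renT ρ θ (lam M)   = lam (renT (ext ρ) θ M)
  renT ρ θ (app M N) = app (renT ρ θ M) (renT ρ θ N)
  renT ρ θ (mu c)    = mu (renC ρ (ext θ) c)

  renC : (ℕ → ℕ) → (ℕ → ℕ) → Cmd → Cmd
  renC ρ θ (named α M) = named (θ α) (renT ρ θ M)

exts : (ℕ → Term) → ℕ → Term
exts σ zero    = var zero
exts σ (suc n) = renT suc id (σ n)

mutual
  subT : (ℕ → Term) → Term → Term
  subT σ (var x)   = σ x
  subT σ (lam M)   = lam (subT (exts σ) M)
  subT σ (app M N) = app (subT σ M) (subT σ N)
  subT σ (mu c)    = mu (subC (λ n → renT id suc (σ n)) c)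

  subC : (ℕ → Term) → Cmd → Cmd
  subC σ (named α M) = named α (subT σ M)

single : Term → ℕ → Term
single N zero    = N
single N (suc n) = var n

_[_/0] : Term → Term → Term
M [ N /0] = subT (single N) M

mutual
  ssubT : ℕ → Term → Term → Term
  ssubT α L (var x)   = var x
  ssubT α L (lam M)   = lam (ssubT α (renT suc id L) M)
  ssubT α L (app M N) = app (ssubT α L M) (ssubT α L N)
  ssubT α L (mu c)    = mu (ssubC (suc α) (renT id suc L) c)

  ssubC : ℕ → Term → Cmd → Cmd
  ssubC α L (named β M) with β ≟ α
  ... | yes _ = named β (app (ssubT α L M) L)
  ... | no  _ = named β (ssubT α L M)

mutual
  data _⟶_ : Term → Term → Set where
    βred  : ∀ {M N} → app (lam M) N ⟶ (M [ N /0])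
    μred  : ∀ {c N} → app (mu c) N ⟶ mu (ssubC zero (renT id suc N) c)
    ξlam  : ∀ {M M'} → M ⟶ M' → lam M ⟶ lam M'
    ξappL : ∀ {M M' N} → M ⟶ M' → app M N ⟶ app M' N
    ξappR : ∀ {M N N'} → N ⟶ N' → app M N ⟶ app M N'
    ξmu   : ∀ {c c'} → c ⟶c c' → mu c ⟶ mu c'

  data _⟶c_ : Cmd → Cmd → Set where
    ξcmd : ∀ {α M M'} → M ⟶ M' → named α M ⟶c named α M'

SN : Term → Set
SN M = ¬ (Σ (ℕ → Term) λ f → (f zero ≡ M) × (∀ i → f i ⟶ f (suc i)))

-- Restricted types (single type constant ψ)
--   arr κ   is  κ → ψ

mutual
  data DTy : Set where
    arr  : CTy → DTy
    _∧ᵈ_ : DTy → DTy → DTy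

  data CTy : Set where
    ω    : CTy
    _⊠_  : DTy → CTy → CTy
    _∧ᶜ_ : CTy → CTy → CTy

mutual
  data _≤D_ : DTy → DTy → Set where
    ≤D-refl  : ∀ {δ} → δ ≤D δ
    ≤D-trans : ∀ {δ₁ δ₂ δ₃} → δ₁ ≤D δ₂ → δ₂ ≤D δ₃ → δ₁ ≤D δ₃
    ≤D-∧l    : ∀ {δ δ'} → (δ ∧ᵈ δ') ≤D δ
    ≤D-∧r    : ∀ {δ δ'} → (δ ∧ᵈ δ') ≤D δ'
    ≤D-∧     : ∀ {δ δ₁ δ₂} → δ ≤D δ₁ → δ ≤D δ₂ → δ ≤D (δ₁ ∧ᵈ δ₂)
    ≤D-arr   : ∀ {κ₁ κ₂} → κ₂ ≤C κ₁ → arr κ₁ ≤D arr κ₂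

  data _≤C_ : CTy → CTy → Set where
    ≤C-refl  : ∀ {κ} → κ ≤C κ
    ≤C-trans : ∀ {κ₁ κ₂ κ₃} → κ₁ ≤C κ₂ → κ₂ ≤C κ₃ → κ₁ ≤C κ₃
    ≤C-∧l    : ∀ {κ κ'} → (κ ∧ᶜ κ') ≤C κ
    ≤C-∧r    : ∀ {κ κ'} → (κ ∧ᶜ κ') ≤C κ'
    ≤C-∧     : ∀ {κ κ₁ κ₂} → κ ≤C κ₁ → κ ≤C κ₂ → κ ≤C (κ₁ ∧ᶜ κ₂)
    ≤C-ω     : ∀ {κ} → κ ≤C ω
    ≤C-dist  : ∀ {δ₁ δ₂ κ₁ κ₂} →
               ((δ₁ ⊠ κ₁) ∧ᶜ (δ₂ ⊠ κ₂)) ≤C ((δ₁ ∧ᵈ δ₂) ⊠ (κ₁ ∧ᶜ κ₂))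
    ≤C-⊠     : ∀ {δ₁ δ₂ κ₁ κ₂} → δ₁ ≤D δ₂ → κ₁ ≤C κ₂ → (δ₁ ⊠ κ₁) ≤C (δ₂ ⊠ κ₂)

-- A basis is a finite partial map from term-variable indices to term types;
-- a context is a finite map from name indices to continuation types,
-- with default ω outside its domain.

Basis : Set
Basis = List (Maybe DTy)

Ctx : Set
Ctx = List CTy

lookupΓ : Basis → ℕ → Maybe DTy
lookupΓ []      _       = nothing
lookupΓ (d ∷ Γ) zero    = d
lookupΓ (d ∷ Γ) (suc x) = lookupΓ Γ x

lookupΔ : Ctx → ℕ → CTy
lookupΔ []      _       = ω
lookupΔ (k ∷ Δ) zero    = k
lookupΔ (k ∷ Δ) (suc α) = lookupΔ Δ α

mutual
  data _⊢r_∶_∣_ : Basis → Term → DTy → Ctx → Set where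
    ax   : ∀ {Γ Δ x δ} → lookupΓ Γ x ≡ just δ → Γ ⊢r var x ∶ δ ∣ Δ
    lamI : ∀ {Γ Δ M δ κ} → (just δ ∷ Γ) ⊢r M ∶ arr κ ∣ Δ →
           Γ ⊢r lam M ∶ arr (δ ⊠ κ) ∣ Δ
    appE : ∀ {Γ Δ M N δ κ} → Γ ⊢r M ∶ arr (δ ⊠ κ) ∣ Δ → Γ ⊢r N ∶ δ ∣ Δ →
           Γ ⊢r app M N ∶ arr κ ∣ Δ
    muI  : ∀ {Γ Δ c κα κ'} → Γ ⊢rc c ∶ (arr κ' ⊠ κ') ∣ (κα ∷ Δ) →
           Γ ⊢r mu c ∶ arr κα ∣ Δ
    ∧I   : ∀ {Γ Δ M δ₁ δ₂} → Γ ⊢r M ∶ δ₁ ∣ Δ → Γ ⊢r M ∶ δ₂ ∣ Δ →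
           Γ ⊢r M ∶ (δ₁ ∧ᵈ δ₂) ∣ Δ
    sub  : ∀ {Γ Δ M δ₁ δ₂} → Γ ⊢r M ∶ δ₁ ∣ Δ → δ₁ ≤D δ₂ → Γ ⊢r M ∶ δ₂ ∣ Δ

  data _⊢rc_∶_∣_ : Basis → Cmd → CTy → Ctx → Set where
    cmd  : ∀ {Γ Δ M α δ} → Γ ⊢r M ∶ δ ∣ Δ →
           Γ ⊢rc named α M ∶ (δ ⊠ lookupΔ Δ α) ∣ Δ
    ∧Ic  : ∀ {Γ Δ c κ₁ κ₂} → Γ ⊢rc c ∶ κ₁ ∣ Δ → Γ ⊢rc c ∶ κ₂ ∣ Δ →
           Γ ⊢rc c ∶ (κ₁ ∧ᶜ κ₂) ∣ Δ
    subc : ∀ {Γ Δ c κ₁ κ₂} → Γ ⊢rc c ∶ κ₁ ∣ Δ → κ₁ ≤C κ₂ → Γ ⊢rc c ∶ κ₂ ∣ Δ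

-- Reducibility for λμ, reading continuation types as predicates on stacks of
-- arguments.  A term M is reducible at κ → ψ when, after any renaming of its free
-- names, M N₁ … Nₖ is strongly normalising for every stack N₁ … Nₖ reducible at κ;
-- ω accepts every stack of strongly normalising terms.  Every type is inhabited
-- by variables and by stacks of variables, so reducible terms are strongly
-- normalising; the subtyping rules are sound for this reading.  λ and μ preserve
-- reducibility because a head redex (λx.B) N S or (μα.c) N S is strongly
-- normalising as soon as its contractum and its parts are, by induction on the
-- strong normalisation of the body and of the stack.  Term substitution, renaming
-- and structural substitution are all instances of one generalised substitution
-- that also appends a stack to every named command, so stability of reduction is
-- proved once.  Adequacy of the type system, instantiated at variables, gives the
-- theorem.

module Submission where

open import Data.Empty using (⊥)
open import Data.List using (List; []; _∷_; _++_; map; length; replicate)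
open import Data.List.Properties using (++-assoc; ++-identityʳ; map-++; map-cong; map-∘; map-id)
open import Data.List.Relation.Unary.All as All using (All; []; _∷_)
open import Data.Maybe using (just)
open import Data.Nat using (ℕ; zero; suc; _≟_; _≤_; _+_; s≤s)
open import Data.Nat.Properties using (≤-trans; ≤-refl; m≤m+n; m≤n+m; suc-injective)
open import Data.Product using (Σ; _×_; _,_)
open import Data.Sum using (_⊎_; inj₁; inj₂)
open import Defs
open import Function using (id; _∘_)
open import Relation.Binary.PropositionalEquality
open import Relation.Nullary using (yes; no; contradiction)

infixl 25 _·_

_·_ : Term → List Term → Term
M · []      = M
M · (N ∷ S) = app M N · S

·-++ : ∀ M S T → M · (S ++ T) ≡ (M · S) · T
·-++ M []      T = refl
·-++ M (N ∷ S) T = ·-++ (app M N) S T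

wkᵗ : Term → Term
wkᵗ = renT suc id

wkⁿ : Term → Term
wkⁿ = renT id suc

_•_ : {A : Set} → A → (ℕ → A) → ℕ → A
(a • f) zero    = a
(a • f) (suc n) = f n

map-square : {A B C D : Set} {f : B → D} {g : A → B} {f' : C → D} {g' : A → C} →
             (∀ x → f (g x) ≡ f' (g' x)) → ∀ xs → map f (map g xs) ≡ map f' (map g' xs)
map-square p xs = trans (sym (map-∘ xs)) (trans (map-cong p xs) (map-∘ xs))

ℕ-cases : {A : Set} {f g : ℕ → A} → f zero ≡ g zero → (∀ n → f (suc n) ≡ g (suc n)) →
          ∀ n → f n ≡ g n
ℕ-cases z s zero    = z
ℕ-cases z s (suc n) = s n

-- Generalised substitution

-- Substitutes for variables, renames names, and turns [α]M into [name α](M · stack α).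
record GSub : Set where
  constructor gsub
  field
    term  : ℕ → Term
    name  : ℕ → ℕ
    stack : ℕ → List Term
open GSub public

liftᵗ : GSub → GSub
liftᵗ s = gsub (var zero • (wkᵗ ∘ term s)) (name s) (map wkᵗ ∘ stack s)

-- Going under a μ whose bound name receives the stack U.
liftⁿ-with : GSub → List Term → GSub
liftⁿ-with s U = gsub (wkⁿ ∘ term s) (ext (name s)) (U • (map wkⁿ ∘ stack s))

liftⁿ : GSub → GSub
liftⁿ s = liftⁿ-with s []

mutual
  apply : GSub → Term → Term
  apply s (var x)   = term s x
  apply s (lam M)   = lam (apply (liftᵗ s) M)
  apply s (app M N) = app (apply s M) (apply s N)
  apply s (mu c)    = mu (applyᶜ (liftⁿ s) c)

  applyᶜ : GSub → Cmd → Cmd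
  applyᶜ s (named α M) = named (name s α) (apply s M · stack s α)

apply-· : ∀ s M S → apply s (M · S) ≡ apply s M · map (apply s) S
apply-· s M []      = refl
apply-· s M (N ∷ S) = apply-· s (app M N) S

record _≐_ (s s' : GSub) : Set where
  constructor pointwise
  field
    term≐  : ∀ x → term s x ≡ term s' x
    name≐  : ∀ α → name s α ≡ name s' α
    stack≐ : ∀ α → stack s α ≡ stack s' α
open _≐_ public

≐-refl : ∀ {s} → s ≐ s
≐-refl = pointwise (λ _ → refl) (λ _ → refl) (λ _ → refl)

liftᵗ-cong : ∀ {s s'} → s ≐ s' → liftᵗ s ≐ liftᵗ s'
liftᵗ-cong p = pointwise (ℕ-cases refl (cong wkᵗ ∘ term≐ p)) (name≐ p) (cong (map wkᵗ) ∘ stack≐ p)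

liftⁿ-cong : ∀ {s s'} → s ≐ s' → liftⁿ s ≐ liftⁿ s'
liftⁿ-cong p = pointwise (cong wkⁿ ∘ term≐ p) (ℕ-cases refl (cong suc ∘ name≐ p))
                         (ℕ-cases refl (cong (map wkⁿ) ∘ stack≐ p))

mutual
  apply-cong : ∀ {s s'} → s ≐ s' → ∀ M → apply s M ≡ apply s' M
  apply-cong p (var x)   = term≐ p x
  apply-cong p (lam M)   = cong lam (apply-cong (liftᵗ-cong p) M)
  apply-cong p (app M N) = cong₂ app (apply-cong p M) (apply-cong p N)
  apply-cong p (mu c)    = cong mu (applyᶜ-cong (liftⁿ-cong p) c)

  applyᶜ-cong : ∀ {s s'} → s ≐ s' → ∀ c → applyᶜ s c ≡ applyᶜ s' c
  applyᶜ-cong p (named α M) = cong₂ named (name≐ p α) (cong₂ _·_ (apply-cong p M) (stack≐ p α))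

ren : (ℕ → ℕ) → (ℕ → ℕ) → GSub
ren r h = gsub (var ∘ r) h (λ _ → [])

mutual
  renT≡apply : ∀ r h M → renT r h M ≡ apply (ren r h) M
  renT≡apply r h (var x)   = refl
  renT≡apply r h (lam M)   =
    cong lam (trans (renT≡apply (ext r) h M)
                    (apply-cong (pointwise (ℕ-cases refl (λ _ → refl)) (λ _ → refl) (λ _ → refl))
                                M))
  renT≡apply r h (app M N) = cong₂ app (renT≡apply r h M) (renT≡apply r h N)
  renT≡apply r h (mu c)    =
    cong mu (trans (renC≡applyᶜ r (ext h) c)
                   (applyᶜ-cong (pointwise (λ _ → refl) (λ _ → refl) (ℕ-cases refl (λ _ → refl)))
                                c))

  renC≡applyᶜ : ∀ r h c → renC r h c ≡ applyᶜ (ren r h) c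
  renC≡applyᶜ r h (named α M) = cong (named (h α)) (renT≡apply r h M)

prerename : GSub → (ℕ → ℕ) → (ℕ → ℕ) → GSub
prerename s r h = gsub (term s ∘ r) (name s ∘ h) (stack s ∘ h)

mutual
  apply-renT : ∀ s r h M → apply s (renT r h M) ≡ apply (prerename s r h) M
  apply-renT s r h (var x)   = refl
  apply-renT s r h (lam M)   =
    cong lam (trans (apply-renT (liftᵗ s) (ext r) h M)
                    (apply-cong (pointwise (ℕ-cases refl (λ _ → refl)) (λ _ → refl) (λ _ → refl))
                                M))
  apply-renT s r h (app M N) = cong₂ app (apply-renT s r h M) (apply-renT s r h N)
  apply-renT s r h (mu c)    =
    cong mu (trans (applyᶜ-renC (liftⁿ s) r (ext h) c)
                   (applyᶜ-cong (pointwise (λ _ → refl) (ℕ-cases refl (λ _ → refl))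
                                           (ℕ-cases refl (λ _ → refl))) c))

  applyᶜ-renC : ∀ s r h c → applyᶜ s (renC r h c) ≡ applyᶜ (prerename s r h) c
  applyᶜ-renC s r h (named α M) =
    cong (λ z → named (name s (h α)) (z · stack s (h α))) (apply-renT s r h M)

renT-renT : ∀ r₂ h₂ r₁ h₁ M → renT r₂ h₂ (renT r₁ h₁ M) ≡ renT (r₂ ∘ r₁) (h₂ ∘ h₁) M
renT-renT r₂ h₂ r₁ h₁ M = begin
  renT r₂ h₂ (renT r₁ h₁ M)          ≡⟨ renT≡apply r₂ h₂ _ ⟩
  apply (ren r₂ h₂) (renT r₁ h₁ M)   ≡⟨ apply-renT _ r₁ h₁ M ⟩
  apply (ren (r₂ ∘ r₁) (h₂ ∘ h₁)) M  ≡⟨ renT≡apply (r₂ ∘ r₁) (h₂ ∘ h₁) M ⟨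
  renT (r₂ ∘ r₁) (h₂ ∘ h₁) M         ∎
  where open ≡-Reasoning

renT-cong : ∀ {r h r' h'} → r ≗ r' → h ≗ h' → ∀ M → renT r h M ≡ renT r' h' M
renT-cong p q M = trans (renT≡apply _ _ M)
                        (trans (apply-cong (pointwise (cong var ∘ p) q (λ _ → refl)) M)
                               (sym (renT≡apply _ _ M)))

renT-wkᵗ : ∀ r h t → renT (ext r) h (wkᵗ t) ≡ wkᵗ (renT r h t)
renT-wkᵗ r h t = trans (renT-renT (ext r) h suc id t)
                       (trans (renT-cong (λ _ → refl) (λ _ → refl) t)
                              (sym (renT-renT suc id r h t)))

renT-wkⁿ : ∀ r h t → renT r (ext h) (wkⁿ t) ≡ wkⁿ (renT r h t)
renT-wkⁿ r h t = trans (renT-renT r (ext h) id suc t)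
                       (trans (renT-cong (λ _ → refl) (λ _ → refl) t)
                              (sym (renT-renT id suc r h t)))

postrename : (ℕ → ℕ) → (ℕ → ℕ) → GSub → GSub
postrename r h s = gsub (renT r h ∘ term s) (h ∘ name s) (map (renT r h) ∘ stack s)

renT-· : ∀ r h M S → renT r h (M · S) ≡ renT r h M · map (renT r h) S
renT-· r h M []      = refl
renT-· r h M (N ∷ S) = renT-· r h (app M N) S

mutual
  renT-apply : ∀ r h s M → renT r h (apply s M) ≡ apply (postrename r h s) M
  renT-apply r h s (var x)   = refl
  renT-apply r h s (lam M)   =
    cong lam (trans (renT-apply (ext r) h (liftᵗ s) M) (apply-cong (pointwise
      (ℕ-cases refl (renT-wkᵗ r h ∘ term s))
      (λ _ → refl)
      (map-square (renT-wkᵗ r h) ∘ stack s)) M))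
  renT-apply r h s (app M N) = cong₂ app (renT-apply r h s M) (renT-apply r h s N)
  renT-apply r h s (mu c)    =
    cong mu (trans (renT-applyᶜ r (ext h) (liftⁿ s) c) (applyᶜ-cong (pointwise
      (renT-wkⁿ r h ∘ term s)
      (ℕ-cases refl (λ _ → refl))
      (ℕ-cases refl (map-square (renT-wkⁿ r h) ∘ stack s))) c))

  renT-applyᶜ : ∀ r h s c → renC r h (applyᶜ s c) ≡ applyᶜ (postrename r h s) c
  renT-applyᶜ r h s (named α M) =
    cong (named (h (name s α)))
         (trans (renT-· r h (apply s M) (stack s α))
                (cong (_· map (renT r h) (stack s α)) (renT-apply r h s M)))

apply-wkᵗ : ∀ s t → apply (liftᵗ s) (wkᵗ t) ≡ wkᵗ (apply s t)
apply-wkᵗ s t = trans (apply-renT (liftᵗ s) suc id t)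
                      (trans (apply-cong ≐-refl t) (sym (renT-apply suc id s t)))

apply-wkⁿ : ∀ s t → apply (liftⁿ s) (wkⁿ t) ≡ wkⁿ (apply s t)
apply-wkⁿ s t = trans (apply-renT (liftⁿ s) id suc t)
                      (trans (apply-cong ≐-refl t) (sym (renT-apply id suc s t)))

_⊙_ : GSub → GSub → GSub
s₂ ⊙ s₁ = gsub (apply s₂ ∘ term s₁) (name s₂ ∘ name s₁)
               (λ α → map (apply s₂) (stack s₁ α) ++ stack s₂ (name s₁ α))

map-++-square : ∀ (f g k : Term → Term) → (∀ t → f (k t) ≡ k (g t)) →
                ∀ U V → map f (map k U) ++ map k V ≡ map k (map g U ++ V)
map-++-square f g k p U V =
  trans (cong (_++ map k V) (map-square p U)) (sym (map-++ k (map g U) V))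

mutual
  apply-apply : ∀ s₂ s₁ M → apply s₂ (apply s₁ M) ≡ apply (s₂ ⊙ s₁) M
  apply-apply s₂ s₁ (var x)   = refl
  apply-apply s₂ s₁ (lam M)   =
    cong lam (trans (apply-apply (liftᵗ s₂) (liftᵗ s₁) M) (apply-cong (pointwise
      (ℕ-cases refl (apply-wkᵗ s₂ ∘ term s₁))
      (λ _ → refl)
      (λ α → map-++-square _ _ wkᵗ (apply-wkᵗ s₂) (stack s₁ α) (stack s₂ (name s₁ α))))
      M))
  apply-apply s₂ s₁ (app M N) = cong₂ app (apply-apply s₂ s₁ M) (apply-apply s₂ s₁ N)
  apply-apply s₂ s₁ (mu c)    =
    cong mu (trans (applyᶜ-applyᶜ (liftⁿ s₂) (liftⁿ s₁) c) (applyᶜ-cong (pointwise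
      (apply-wkⁿ s₂ ∘ term s₁)
      (ℕ-cases refl (λ _ → refl))
      (ℕ-cases refl (λ α → map-++-square _ _ wkⁿ (apply-wkⁿ s₂)
                                         (stack s₁ α) (stack s₂ (name s₁ α))))) c))

  applyᶜ-applyᶜ : ∀ s₂ s₁ c → applyᶜ s₂ (applyᶜ s₁ c) ≡ applyᶜ (s₂ ⊙ s₁) c
  applyᶜ-applyᶜ s₂ s₁ (named α M) = cong (named (name s₂ (name s₁ α))) (begin
    apply s₂ (apply s₁ M · S₁) · S₂          ≡⟨ cong (_· S₂) (apply-· s₂ (apply s₁ M) S₁) ⟩
    apply s₂ (apply s₁ M) · S₁' · S₂         ≡⟨ ·-++ _ S₁' S₂ ⟨
    apply s₂ (apply s₁ M) · (S₁' ++ S₂)      ≡⟨ cong (_· (S₁' ++ S₂)) (apply-apply s₂ s₁ M) ⟩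
    apply (s₂ ⊙ s₁) M · (S₁' ++ S₂)          ∎)
    where
      open ≡-Reasoning
      S₁ = stack s₁ α
      S₁' = map (apply s₂) S₁
      S₂ = stack s₂ (name s₁ α)

mutual
  apply-id : ∀ M → apply (ren id id) M ≡ M
  apply-id (var x)   = refl
  apply-id (lam M)   =
    cong lam (trans (apply-cong (pointwise (ℕ-cases refl (λ _ → refl)) (λ _ → refl) (λ _ → refl)) M)
                    (apply-id M))
  apply-id (app M N) = cong₂ app (apply-id M) (apply-id N)
  apply-id (mu c)    =
    cong mu (trans (applyᶜ-cong (pointwise (λ _ → refl) (ℕ-cases refl (λ _ → refl))
                                           (ℕ-cases refl (λ _ → refl))) c)
                   (applyᶜ-id c))

  applyᶜ-id : ∀ c → applyᶜ (ren id id) c ≡ c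
  applyᶜ-id (named α M) = cong (named α) (apply-id M)

renT-id : ∀ M → renT id id M ≡ M
renT-id M = trans (renT≡apply id id M) (apply-id M)

substitution : (ℕ → Term) → GSub
substitution σ = gsub σ id (λ _ → [])

mutual
  subT≡apply : ∀ σ M → subT σ M ≡ apply (substitution σ) M
  subT≡apply σ (var x)   = refl
  subT≡apply σ (lam M)   =
    cong lam (trans (subT≡apply (exts σ) M)
                    (apply-cong (pointwise (ℕ-cases refl (λ _ → refl)) (λ _ → refl) (λ _ → refl))
                                M))
  subT≡apply σ (app M N) = cong₂ app (subT≡apply σ M) (subT≡apply σ N)
  subT≡apply σ (mu c)    =
    cong mu (trans (subC≡applyᶜ _ c)
                   (applyᶜ-cong (pointwise (λ _ → refl) (ℕ-cases refl (λ _ → refl))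
                                           (ℕ-cases refl (λ _ → refl))) c))

  subC≡applyᶜ : ∀ σ c → subC σ c ≡ applyᶜ (substitution σ) c
  subC≡applyᶜ σ (named α M) = cong (named α) (subT≡apply σ M)

_▸_ : Term → GSub → GSub
P ▸ s = gsub (P • term s) (name s) (stack s)

substitution-wkᵗ : ∀ P t → apply (substitution (single P)) (wkᵗ t) ≡ t
substitution-wkᵗ P t = trans (apply-renT _ suc id t) (apply-id t)

liftᵗ-[/0] : ∀ P s M → apply (liftᵗ s) M [ P /0] ≡ apply (P ▸ s) M
liftᵗ-[/0] P s M = begin
  subT (single P) (apply (liftᵗ s) M)                  ≡⟨ subT≡apply (single P) (apply _ M) ⟩
  apply (substitution (single P)) (apply (liftᵗ s) M)  ≡⟨ apply-apply _ (liftᵗ s) M ⟩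
  apply (substitution (single P) ⊙ liftᵗ s) M          ≡⟨ apply-cong (pointwise
    (ℕ-cases refl (substitution-wkᵗ P ∘ term s)) (λ _ → refl)
    (λ α → trans (++-identityʳ _) (map-wkᵗ (stack s α)))) M ⟩
  apply (P ▸ s) M                                      ∎
  where
    open ≡-Reasoning
    map-wkᵗ : ∀ U → map (apply (substitution (single P))) (map wkᵗ U) ≡ U
    map-wkᵗ U = trans (sym (map-∘ U)) (trans (map-cong (substitution-wkᵗ P) U) (map-id U))

apply-[/0] : ∀ s N M → apply s (M [ N /0]) ≡ apply (apply s N ▸ s) M
apply-[/0] s N M =
  trans (cong (apply s) (subT≡apply (single N) M))
        (trans (apply-apply s (substitution (single N)) M)
               (apply-cong (pointwise (ℕ-cases refl (λ _ → refl)) (λ _ → refl) (λ _ → refl)) M))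

stackAt : ℕ → Term → ℕ → List Term
stackAt α L β with β ≟ α
... | yes _ = L ∷ []
... | no  _ = []

structural : ℕ → Term → GSub
structural α L = gsub var id (stackAt α L)

stackAt-wkᵗ : ∀ α L β → stackAt α (wkᵗ L) β ≡ map wkᵗ (stackAt α L β)
stackAt-wkᵗ α L β with β ≟ α
... | yes _ = refl
... | no  _ = refl

stackAt-suc : ∀ α L β → stackAt (suc α) (wkⁿ L) (suc β) ≡ map wkⁿ (stackAt α L β)
stackAt-suc α L β with suc β ≟ suc α | β ≟ α
... | yes _     | yes _   = refl
... | no  _     | no  _   = refl
... | yes sβ≡sα | no  β≢α = contradiction (suc-injective sβ≡sα) β≢α
... | no  sβ≢sα | yes β≡α = contradiction (cong suc β≡α) sβ≢sα

mutual
  ssubT≡apply : ∀ α L M → ssubT α L M ≡ apply (structural α L) M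
  ssubT≡apply α L (var x)   = refl
  ssubT≡apply α L (lam M)   =
    cong lam (trans (ssubT≡apply α (wkᵗ L) M)
                    (apply-cong (pointwise (ℕ-cases refl (λ _ → refl)) (λ _ → refl)
                                           (stackAt-wkᵗ α L))
                                M))
  ssubT≡apply α L (app M N) = cong₂ app (ssubT≡apply α L M) (ssubT≡apply α L N)
  ssubT≡apply α L (mu c)    =
    cong mu (trans (ssubC≡applyᶜ (suc α) (wkⁿ L) c)
                   (applyᶜ-cong (pointwise (λ _ → refl) (ℕ-cases refl (λ _ → refl))
                                           (ℕ-cases refl (stackAt-suc α L))) c))

  ssubC≡applyᶜ : ∀ α L c → ssubC α L c ≡ applyᶜ (structural α L) c
  ssubC≡applyᶜ α L (named β M) with β ≟ α
  ... | yes _ = cong (λ z → named β (app z L)) (ssubT≡apply α L M)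
  ... | no  _ = cong (named β) (ssubT≡apply α L M)

structural-wkⁿ : ∀ L t → apply (structural zero L) (wkⁿ t) ≡ wkⁿ t
structural-wkⁿ L t =
  trans (apply-renT (structural zero L) id suc t)
        (trans (apply-cong ≐-refl t) (sym (renT≡apply id suc t)))

map-structural-wkⁿ : ∀ L U → map (apply (structural zero L)) (map wkⁿ U) ≡ map wkⁿ U
map-structural-wkⁿ L []      = refl
map-structural-wkⁿ L (t ∷ U) = cong₂ _∷_ (structural-wkⁿ L t) (map-structural-wkⁿ L U)

ssubC-liftⁿ-with : ∀ s U L c → map (apply (structural zero L)) U ≡ U →
                   ssubC zero L (applyᶜ (liftⁿ-with s U) c) ≡ applyᶜ (liftⁿ-with s (U ++ L ∷ [])) c
ssubC-liftⁿ-with s U L c fixU =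
  trans (ssubC≡applyᶜ zero L _)
        (trans (applyᶜ-applyᶜ (structural zero L) (liftⁿ-with s U) c) (applyᶜ-cong (pointwise
          (structural-wkⁿ L ∘ term s) (λ _ → refl)
          (ℕ-cases (cong (_++ L ∷ []) fixU)
                   (λ α → trans (++-identityʳ _) (map-structural-wkⁿ L (stack s α))))) c))

applyᶜ-ssubC : ∀ s N c → applyᶜ (liftⁿ s) (ssubC zero (wkⁿ N) c)
                       ≡ applyᶜ (liftⁿ-with s (wkⁿ (apply s N) ∷ [])) c
applyᶜ-ssubC s N c =
  trans (cong (applyᶜ (liftⁿ s)) (ssubC≡applyᶜ zero (wkⁿ N) c))
        (trans (applyᶜ-applyᶜ (liftⁿ s) (structural zero (wkⁿ N)) c) (applyᶜ-cong (pointwise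
          (λ _ → refl) (λ _ → refl)
          (ℕ-cases (cong (_∷ []) (apply-wkⁿ s N)) (λ _ → refl))) c))

_⇐⋆_ : Cmd → List Term → Cmd
c ⇐⋆ []      = c
c ⇐⋆ (N ∷ T) = ssubC zero (wkⁿ N) c ⇐⋆ T

liftⁿ-with-⇐⋆ : ∀ s T U c → applyᶜ (liftⁿ-with s (map wkⁿ U)) c ⇐⋆ T
                          ≡ applyᶜ (liftⁿ-with s (map wkⁿ (U ++ T))) c
liftⁿ-with-⇐⋆ s []      U c =
  cong (λ z → applyᶜ (liftⁿ-with s (map wkⁿ z)) c) (sym (++-identityʳ U))
liftⁿ-with-⇐⋆ s (N ∷ T) U c = begin
  ssubC zero (wkⁿ N) (applyᶜ (liftⁿ-with s (map wkⁿ U)) c) ⇐⋆ T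
    ≡⟨ cong (_⇐⋆ T) (ssubC-liftⁿ-with s (map wkⁿ U) (wkⁿ N) c (map-structural-wkⁿ (wkⁿ N) U)) ⟩
  applyᶜ (liftⁿ-with s (map wkⁿ U ++ wkⁿ N ∷ [])) c ⇐⋆ T
    ≡⟨ cong (λ z → applyᶜ (liftⁿ-with s z) c ⇐⋆ T) (map-++ wkⁿ U (N ∷ [])) ⟨
  applyᶜ (liftⁿ-with s (map wkⁿ (U ++ N ∷ []))) c ⇐⋆ T
    ≡⟨ liftⁿ-with-⇐⋆ s T (U ++ N ∷ []) c ⟩
  applyᶜ (liftⁿ-with s (map wkⁿ ((U ++ N ∷ []) ++ T))) c
    ≡⟨ cong (λ z → applyᶜ (liftⁿ-with s (map wkⁿ z)) c) (++-assoc U (N ∷ []) T) ⟩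
  applyᶜ (liftⁿ-with s (map wkⁿ (U ++ N ∷ T))) c
    ∎
  where open ≡-Reasoning

·-⟶ : ∀ {M M'} S → M ⟶ M' → M · S ⟶ M' · S
·-⟶ []      st = st
·-⟶ (N ∷ S) st = ·-⟶ S (ξappL st)

mutual
  apply-⟶ : ∀ s {M M'} → M ⟶ M' → apply s M ⟶ apply s M'
  apply-⟶ s (βred {M} {N}) =
    subst (app (lam (apply (liftᵗ s) M)) (apply s N) ⟶_)
          (trans (liftᵗ-[/0] (apply s N) s M) (sym (apply-[/0] s N M))) βred
  apply-⟶ s (μred {c} {N}) =
    subst (λ z → app (mu (applyᶜ (liftⁿ s) c)) (apply s N) ⟶ mu z)
          (trans (ssubC-liftⁿ-with s [] _ c refl) (sym (applyᶜ-ssubC s N c))) μred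
  apply-⟶ s (ξlam st)  = ξlam (apply-⟶ (liftᵗ s) st)
  apply-⟶ s (ξappL st) = ξappL (apply-⟶ s st)
  apply-⟶ s (ξappR st) = ξappR (apply-⟶ s st)
  apply-⟶ s (ξmu st)   = ξmu (applyᶜ-⟶c (liftⁿ s) st)

  applyᶜ-⟶c : ∀ s {c c'} → c ⟶c c' → applyᶜ s c ⟶c applyᶜ s c'
  applyᶜ-⟶c s (ξcmd {α} st) = ξcmd (·-⟶ (stack s α) (apply-⟶ s st))

[/0]-⟶ : ∀ N {M M'} → M ⟶ M' → (M [ N /0]) ⟶ (M' [ N /0])
[/0]-⟶ N {M} {M'} st =
  subst₂ _⟶_ (sym (subT≡apply _ M)) (sym (subT≡apply _ M')) (apply-⟶ (substitution (single N)) st)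

renT-⟶ : ∀ r h {M M'} → M ⟶ M' → renT r h M ⟶ renT r h M'
renT-⟶ r h {M} {M'} st =
  subst₂ _⟶_ (sym (renT≡apply r h M)) (sym (renT≡apply r h M')) (apply-⟶ (ren r h) st)

ssubC-⟶c : ∀ L {c c'} → c ⟶c c' → ssubC zero L c ⟶c ssubC zero L c'
ssubC-⟶c L {c} {c'} st =
  subst₂ _⟶c_ (sym (ssubC≡applyᶜ zero L c)) (sym (ssubC≡applyᶜ zero L c'))
         (applyᶜ-⟶c (structural zero L) st)

⇐⋆-⟶c : ∀ T {c c'} → c ⟶c c' → (c ⇐⋆ T) ⟶c (c' ⇐⋆ T)
⇐⋆-⟶c []      st = st
⇐⋆-⟶c (N ∷ T) st = ⇐⋆-⟶c T (ssubC-⟶c (wkⁿ N) st)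

data sn (M : Term) : Set where
  acc : (∀ {M'} → M ⟶ M' → sn M') → sn M

sn-⟶ : ∀ {M M'} → sn M → M ⟶ M' → sn M'
sn-⟶ (acc f) st = f st

sn⇒SN : ∀ {M} → sn M → SN M
sn⇒SN s (f , f0≡M , steps) = no-chain s zero f0≡M
  where
    no-chain : ∀ {M} → sn M → ∀ i → f i ≡ M → ⊥
    no-chain (acc g) i refl = no-chain (g (steps i)) (suc i) refl

sn-reflect : (f : Term → Term) → (∀ {M M'} → M ⟶ M' → f M ⟶ f M') → ∀ {M} → sn (f M) → sn M
sn-reflect f f-⟶ (acc g) = acc λ st → sn-reflect f f-⟶ (g (f-⟶ st))

sn-·-head : ∀ {M} S → sn (M · S) → sn M
sn-·-head S = sn-reflect (_· S) (·-⟶ S)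

sn-renT-id : ∀ {M} → sn (renT id id M) → sn M
sn-renT-id = sn-reflect (renT id id) (renT-⟶ id id)

sn-var : ∀ {x} → sn (var x)
sn-var = acc λ ()

sn-mu-named : ∀ {α M} → sn M → sn (mu (named α M))
sn-mu-named (acc g) = acc λ { (ξmu (ξcmd st)) → sn-mu-named (g st) }

sn-mu-⇐⋆ : ∀ T {c} → sn (mu (c ⇐⋆ T)) → sn (mu c)
sn-mu-⇐⋆ T (acc g) = acc λ { (ξmu st) → sn-mu-⇐⋆ T (g (ξmu (⇐⋆-⟶c T st))) }

data Neutral : Term → Set where
  var : ∀ {x} → Neutral (var x)
  app : ∀ {H N} → Neutral H → Neutral (app H N)

Neutral-⟶ : ∀ {H H'} → Neutral H → H ⟶ H' → Neutral H'
Neutral-⟶ (app ()) βred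
Neutral-⟶ (app ()) μred
Neutral-⟶ (app n)  (ξappL st) = app (Neutral-⟶ n st)
Neutral-⟶ (app n)  (ξappR st) = app n

-- A neutral head creates no redex, so only the parts reduce.
sn-neutral-app : ∀ {H N} → Neutral H → sn H → sn N → sn (app H N)
sn-neutral-app {H} {N} n (acc gH) (acc gN) = acc (step n)
  where
    step : ∀ {X} → Neutral H → app H N ⟶ X → sn X
    step () βred
    step () μred
    step n (ξappL st) = sn-neutral-app (Neutral-⟶ n st) (gH st) (acc gN)
    step n (ξappR st) = sn-neutral-app n (acc gH) (gN st)

sn-neutral-· : ∀ {H} S → Neutral H → sn H → All sn S → sn (H · S)
sn-neutral-· []      n sH []         = sH
sn-neutral-· (N ∷ S) n sH (sN ∷ sS) = sn-neutral-· S (app n) (sn-neutral-app n sH sN) sS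

data _⟶ˢ_ : List Term → List Term → Set where
  here  : ∀ {N N' S} → N ⟶ N' → (N ∷ S) ⟶ˢ (N' ∷ S)
  there : ∀ {N S S'} → S ⟶ˢ S' → (N ∷ S) ⟶ˢ (N ∷ S')

data snˢ (S : List Term) : Set where
  acc : (∀ {S'} → S ⟶ˢ S' → snˢ S') → snˢ S

snˢ-∷ : ∀ {N S} → sn N → snˢ S → snˢ (N ∷ S)
snˢ-∷ (acc g) (acc h) = acc λ
  { (here st)  → snˢ-∷ (g st) (acc h)
  ; (there st) → snˢ-∷ (acc g) (h st)
  }

All-sn⇒snˢ : ∀ {S} → All sn S → snˢ S
All-sn⇒snˢ []        = acc λ ()
All-sn⇒snˢ (sN ∷ sS) = snˢ-∷ sN (All-sn⇒snˢ sS)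

⟶ˢ-length : ∀ {S S'} → S ⟶ˢ S' → length S' ≡ length S
⟶ˢ-length (here st)  = refl
⟶ˢ-length (there st) = cong suc (⟶ˢ-length st)

data IsApp : Term → Set where
  app : ∀ {M N} → IsApp (app M N)

-- An application head is neither a λ nor a μ, so no redex straddles H and S.
·-⟶-inv : ∀ {H X} S → IsApp H → H · S ⟶ X →
          (Σ Term λ H' → H ⟶ H' × X ≡ H' · S) ⊎ (Σ (List Term) λ S' → S ⟶ˢ S' × X ≡ H · S')
·-⟶-inv []      _   st = inj₁ (_ , st , refl)
·-⟶-inv (N ∷ S) app st with ·-⟶-inv S app st
... | inj₂ (S' , st' , refl)         = inj₂ (N ∷ S' , there st' , refl)
... | inj₁ (_ , ξappL st' , refl)    = inj₁ (_ , st' , refl)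
... | inj₁ (_ , ξappR st' , refl)    = inj₂ (_ ∷ S , here st' , refl)

record IsCandidate (P : List Term → Set) : Set where
  field
    ⟶ˢ-closed : ∀ {S S'} → P S → S ⟶ˢ S' → P S'
    sn-all     : ∀ {S} → P S → All sn S
open IsCandidate public

IsCandidate-tail : ∀ {P} N → IsCandidate P → IsCandidate (λ T → P (N ∷ T))
IsCandidate-tail N cand = record
  { ⟶ˢ-closed = λ p st → ⟶ˢ-closed cand p (there st)
  ; sn-all     = All.tail ∘ sn-all cand
  }

sn-lam-· : ∀ {P} → IsCandidate P → ∀ B → (∀ N S → P (N ∷ S) → sn ((B [ N /0]) · S)) →
           ∀ N S → P (N ∷ S) → sn (app (lam B) N · S)
sn-lam-· {P} cand B red N S p =
  sn-redex B red (sn-reflect (_[ N /0]) ([/0]-⟶ N) (sn-·-head S (red N S p)))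
           p (All-sn⇒snˢ (sn-all cand p))
  where
    sn-redex : ∀ B → (∀ N S → P (N ∷ S) → sn ((B [ N /0]) · S)) → sn B →
               ∀ {N S} → P (N ∷ S) → snˢ (N ∷ S) → sn (app (lam B) N · S)
    sn-redex B red (acc gB) {N} {S} p (acc gS) = acc step
      where
        step : ∀ {X} → app (lam B) N · S ⟶ X → sn X
        step st with ·-⟶-inv S app st
        ... | inj₂ (_ , st' , refl)             =
                sn-redex B red (acc gB) (⟶ˢ-closed cand p (there st')) (gS (there st'))
        ... | inj₁ (_ , βred , refl)            = red N S p
        ... | inj₁ (_ , ξappL (ξlam st') , refl) =
                sn-redex _ (λ N S p → sn-⟶ (red N S p) (·-⟶ S ([/0]-⟶ N st'))) (gB st') p (acc gS)
        ... | inj₁ (_ , ξappR st' , refl)       =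
                sn-redex B red (acc gB) (⟶ˢ-closed cand p (here st')) (gS (here st'))

-- The length index n is there only for termination: a μ-contraction consumes one argument.
mutual
  sn-mu-· : ∀ {P} n → IsCandidate P → ∀ c → (∀ T → P T → sn (mu (c ⇐⋆ T))) →
            ∀ T → length T ≡ n → P T → sn (mu c · T)
  sn-mu-· _       cand c red []      _   p = red [] p
  sn-mu-· (suc n) cand c red (N ∷ T) len p =
    sn-mu-redex n cand c red (sn-mu-⇐⋆ (N ∷ T) (red (N ∷ T) p)) (suc-injective len)
                p (All-sn⇒snˢ (sn-all cand p))

  sn-mu-redex : ∀ {P} n → IsCandidate P → ∀ c → (∀ T → P T → sn (mu (c ⇐⋆ T))) → sn (mu c) →
                ∀ {N T} → length T ≡ n → P (N ∷ T) → snˢ (N ∷ T) → sn (app (mu c) N · T)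
  sn-mu-redex n cand c red (acc gc) {N} {T} len p (acc gS) = acc step
    where
      step : ∀ {X} → app (mu c) N · T ⟶ X → sn X
      step st with ·-⟶-inv T app st
      ... | inj₂ (_ , st' , refl)            =
              sn-mu-redex n cand c red (acc gc) (trans (⟶ˢ-length st') len)
                          (⟶ˢ-closed cand p (there st')) (gS (there st'))
      ... | inj₁ (_ , μred , refl)           =
              sn-mu-· n (IsCandidate-tail N cand) (ssubC zero (wkⁿ N) c) (λ T → red (N ∷ T)) T len p
      ... | inj₁ (_ , ξappL (ξmu st') , refl) =
              sn-mu-redex n cand _ (λ T q → sn-⟶ (red T q) (ξmu (⇐⋆-⟶c T st'))) (gc (ξmu st'))
                          len p (acc gS)
      ... | inj₁ (_ , ξappR st' , refl)      =
              sn-mu-redex n cand c red (acc gc) len (⟶ˢ-closed cand p (here st')) (gS (here st'))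

-- Reducibility

RenSN : Term → Set
RenSN N = ∀ r → sn (renT id r N)

-- Quantifying over renamings of names makes reducibility survive the shift of
-- free names that happens when a substitution goes under a μ.
mutual
  ⟦_⟧ᵈ : DTy → Term → Set
  ⟦ arr κ ⟧ᵈ    M = ∀ r S → ⟦ κ ⟧ᶜ S → sn (renT id r M · S)
  ⟦ δ ∧ᵈ δ' ⟧ᵈ M = ⟦ δ ⟧ᵈ M × ⟦ δ' ⟧ᵈ M

  ⟦_⟧ᶜ : CTy → List Term → Set
  ⟦ ω ⟧ᶜ       S       = All RenSN S
  ⟦ δ ⊠ κ ⟧ᶜ   []      = ⊥
  ⟦ δ ⊠ κ ⟧ᶜ   (N ∷ S) = ⟦ δ ⟧ᵈ N × ⟦ κ ⟧ᶜ S
  ⟦ κ ∧ᶜ κ' ⟧ᶜ S       = ⟦ κ ⟧ᶜ S × ⟦ κ' ⟧ᶜ S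

⟦arr⟧-· : ∀ {κ M S} → ⟦ arr κ ⟧ᵈ M → ⟦ κ ⟧ᶜ S → sn (M · S)
⟦arr⟧-· {M = M} {S} h k = subst (λ z → sn (z · S)) (renT-id M) (h id S k)

RenSN⇒sn : ∀ {N} → RenSN N → sn N
RenSN⇒sn h = sn-renT-id (h id)

RenSN-rename : ∀ {N} → RenSN N → ∀ r → RenSN (renT id r N)
RenSN-rename {N} h r r' = subst sn (sym (renT-renT id r' id r N)) (h (r' ∘ r))

⟦⟧ᵈ-rename : ∀ δ {M} → ⟦ δ ⟧ᵈ M → ∀ r → ⟦ δ ⟧ᵈ (renT id r M)
⟦⟧ᵈ-rename (arr κ)   {M} h r r' S k =
  subst (λ z → sn (z · S)) (sym (renT-renT id r' id r M)) (h (r' ∘ r) S k)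
⟦⟧ᵈ-rename (δ ∧ᵈ δ') (h , h') r = ⟦⟧ᵈ-rename δ h r , ⟦⟧ᵈ-rename δ' h' r

⟦⟧ᶜ-rename : ∀ κ {S} → ⟦ κ ⟧ᶜ S → ∀ r → ⟦ κ ⟧ᶜ (map (renT id r) S)
⟦⟧ᶜ-rename ω         []       r = []
⟦⟧ᶜ-rename ω         (h ∷ hs) r = RenSN-rename h r ∷ ⟦⟧ᶜ-rename ω hs r
⟦⟧ᶜ-rename (δ ⊠ κ)   {N ∷ S} (d , k) r = ⟦⟧ᵈ-rename δ d r , ⟦⟧ᶜ-rename κ k r
⟦⟧ᶜ-rename (κ ∧ᶜ κ') (k , k') r = ⟦⟧ᶜ-rename κ k r , ⟦⟧ᶜ-rename κ' k' r

⟦⟧ᵈ-⟶ : ∀ δ {M M'} → ⟦ δ ⟧ᵈ M → M ⟶ M' → ⟦ δ ⟧ᵈ M'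
⟦⟧ᵈ-⟶ (arr κ)   h st r S k = sn-⟶ (h r S k) (·-⟶ S (renT-⟶ id r st))
⟦⟧ᵈ-⟶ (δ ∧ᵈ δ') (h , h') st = ⟦⟧ᵈ-⟶ δ h st , ⟦⟧ᵈ-⟶ δ' h' st

⟦⟧ᶜ-⟶ˢ : ∀ κ {S S'} → ⟦ κ ⟧ᶜ S → S ⟶ˢ S' → ⟦ κ ⟧ᶜ S'
⟦⟧ᶜ-⟶ˢ ω         (h ∷ hs) (here st)  = (λ r → sn-⟶ (h r) (renT-⟶ id r st)) ∷ hs
⟦⟧ᶜ-⟶ˢ ω         (h ∷ hs) (there st) = h ∷ ⟦⟧ᶜ-⟶ˢ ω hs st
⟦⟧ᶜ-⟶ˢ (δ ⊠ κ)   (d , k)  (here st)  = ⟦⟧ᵈ-⟶ δ d st , k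
⟦⟧ᶜ-⟶ˢ (δ ⊠ κ)   (d , k)  (there st) = d , ⟦⟧ᶜ-⟶ˢ κ k st
⟦⟧ᶜ-⟶ˢ (κ ∧ᶜ κ') (k , k') st         = ⟦⟧ᶜ-⟶ˢ κ k st , ⟦⟧ᶜ-⟶ˢ κ' k' st

-- The number of arguments a stack needs to inhabit ⟦ κ ⟧ᶜ.
width : CTy → ℕ
width ω         = zero
width (δ ⊠ κ)   = suc (width κ)
width (κ ∧ᶜ κ') = width κ + width κ'

vars : ℕ → List Term
vars m = replicate m (var zero)

All-RenSN-vars : ∀ m → All RenSN (vars m)
All-RenSN-vars zero    = []
All-RenSN-vars (suc m) = (λ _ → sn-var) ∷ All-RenSN-vars m

mutual
  ⟦⟧ᵈ⇒sn : ∀ δ {M} → ⟦ δ ⟧ᵈ M → sn M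
  ⟦⟧ᵈ⇒sn (arr κ)   h = sn-·-head (vars (width κ)) (⟦arr⟧-· h (⟦⟧ᶜ-vars κ ≤-refl))
  ⟦⟧ᵈ⇒sn (δ ∧ᵈ δ') (h , _) = ⟦⟧ᵈ⇒sn δ h

  ⟦⟧ᶜ⇒RenSN : ∀ κ {S} → ⟦ κ ⟧ᶜ S → All RenSN S
  ⟦⟧ᶜ⇒RenSN ω         hs      = hs
  ⟦⟧ᶜ⇒RenSN (δ ⊠ κ)   {N ∷ S} (d , k) = (λ r → ⟦⟧ᵈ⇒sn δ (⟦⟧ᵈ-rename δ d r)) ∷ ⟦⟧ᶜ⇒RenSN κ k
  ⟦⟧ᶜ⇒RenSN (κ ∧ᶜ κ') (k , _) = ⟦⟧ᶜ⇒RenSN κ k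

  ⟦⟧ᵈ-var : ∀ δ x → ⟦ δ ⟧ᵈ (var x)
  ⟦⟧ᵈ-var (arr κ)   x r S k = sn-neutral-· S var sn-var (All.map RenSN⇒sn (⟦⟧ᶜ⇒RenSN κ k))
  ⟦⟧ᵈ-var (δ ∧ᵈ δ') x = ⟦⟧ᵈ-var δ x , ⟦⟧ᵈ-var δ' x

  ⟦⟧ᶜ-vars : ∀ κ {m} → width κ ≤ m → ⟦ κ ⟧ᶜ (vars m)
  ⟦⟧ᶜ-vars ω         {m}     _         = All-RenSN-vars m
  ⟦⟧ᶜ-vars (δ ⊠ κ)   {suc m} (s≤s le) = ⟦⟧ᵈ-var δ zero , ⟦⟧ᶜ-vars κ le
  ⟦⟧ᶜ-vars (κ ∧ᶜ κ') le =
    ⟦⟧ᶜ-vars κ (≤-trans (m≤m+n (width κ) (width κ')) le) ,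
    ⟦⟧ᶜ-vars κ' (≤-trans (m≤n+m (width κ') (width κ)) le)

⟦⟧ᶜ-candidate : ∀ κ → IsCandidate ⟦ κ ⟧ᶜ
⟦⟧ᶜ-candidate κ = record
  { ⟶ˢ-closed = ⟦⟧ᶜ-⟶ˢ κ
  ; sn-all     = All.map RenSN⇒sn ∘ ⟦⟧ᶜ⇒RenSN κ
  }

mutual
  ≤D-sound : ∀ {δ₁ δ₂ M} → δ₁ ≤D δ₂ → ⟦ δ₁ ⟧ᵈ M → ⟦ δ₂ ⟧ᵈ M
  ≤D-sound ≤D-refl        h       = h
  ≤D-sound (≤D-trans p q) h       = ≤D-sound q (≤D-sound p h)
  ≤D-sound ≤D-∧l          (h , _) = h
  ≤D-sound ≤D-∧r          (_ , h) = h
  ≤D-sound (≤D-∧ p q)     h       = ≤D-sound p h , ≤D-sound q h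
  ≤D-sound (≤D-arr p)     h       = λ r S k → h r S (≤C-sound p k)

  ≤C-sound : ∀ {κ₁ κ₂ S} → κ₁ ≤C κ₂ → ⟦ κ₁ ⟧ᶜ S → ⟦ κ₂ ⟧ᶜ S
  ≤C-sound ≤C-refl        k       = k
  ≤C-sound (≤C-trans p q) k       = ≤C-sound q (≤C-sound p k)
  ≤C-sound ≤C-∧l          (k , _) = k
  ≤C-sound ≤C-∧r          (_ , k) = k
  ≤C-sound (≤C-∧ p q)     k       = ≤C-sound p k , ≤C-sound q k
  ≤C-sound {κ₁} ≤C-ω      k       = ⟦⟧ᶜ⇒RenSN κ₁ k
  ≤C-sound {S = N ∷ S} ≤C-dist    ((d₁ , k₁) , (d₂ , k₂)) = (d₁ , d₂) , (k₁ , k₂)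
  ≤C-sound {S = N ∷ S} (≤C-⊠ p q) (d , k) = ≤D-sound p d , ≤C-sound q k

-- Adequacy

record Reducible (Γ : Basis) (Δ : Ctx) (s : GSub) : Set where
  field
    term-reducible  : ∀ {x δ} → lookupΓ Γ x ≡ just δ → ⟦ δ ⟧ᵈ (term s x)
    stack-reducible : ∀ α → ⟦ lookupΔ Δ α ⟧ᶜ (stack s α)
open Reducible public

Reducible-rename : ∀ {Γ Δ s} → Reducible Γ Δ s → ∀ r → Reducible Γ Δ (postrename id r s)
Reducible-rename {Δ = Δ} R r = record
  { term-reducible  = λ {_} {δ} p → ⟦⟧ᵈ-rename δ (term-reducible R p) r
  ; stack-reducible = λ α → ⟦⟧ᶜ-rename (lookupΔ Δ α) (stack-reducible R α) r
  }

Reducible-▸ : ∀ {Γ Δ s δ N} → Reducible Γ Δ s → ⟦ δ ⟧ᵈ N → Reducible (just δ ∷ Γ) Δ (N ▸ s)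
Reducible-▸ R d = record
  { term-reducible  = λ { {zero} refl → d ; {suc x} p → term-reducible R p }
  ; stack-reducible = stack-reducible R
  }

Reducible-liftⁿ-with : ∀ {Γ Δ s κ U} → Reducible Γ Δ s → ⟦ κ ⟧ᶜ U →
                       Reducible Γ (κ ∷ Δ) (liftⁿ-with s (map wkⁿ U))
Reducible-liftⁿ-with {Δ = Δ} {κ = κ} R k = record
  { term-reducible  = λ {_} {δ} p → ⟦⟧ᵈ-rename δ (term-reducible R p) suc
  ; stack-reducible = λ { zero → ⟦⟧ᶜ-rename κ k suc
                        ; (suc α) → ⟦⟧ᶜ-rename (lookupΔ Δ α) (stack-reducible R α) suc }
  }

⟦arr⟧-intro : ∀ {Γ Δ κ} M → (∀ {s} → Reducible Γ Δ s → ∀ S → ⟦ κ ⟧ᶜ S → sn (apply s M · S)) →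
              ∀ {s} → Reducible Γ Δ s → ⟦ arr κ ⟧ᵈ (apply s M)
⟦arr⟧-intro M h {s} R r S k =
  subst (λ z → sn (z · S)) (sym (renT-apply id r s M)) (h (Reducible-rename R r) S k)

command-stack : GSub → Cmd → List Term
command-stack s (named α M) = apply s M ∷ stack s α

sn-mu-command : ∀ {κ s c} → ⟦ arr κ ⊠ κ ⟧ᶜ (command-stack s c) → sn (mu (applyᶜ s c))
sn-mu-command {c = named α M} (d , k) = sn-mu-named (⟦arr⟧-· d k)

mutual
  adequacy : ∀ {Γ Δ M δ} → Γ ⊢r M ∶ δ ∣ Δ → ∀ {s} → Reducible Γ Δ s → ⟦ δ ⟧ᵈ (apply s M)
  adequacy (ax p)     R = term-reducible R p
  adequacy (∧I d d')  R = adequacy d R , adequacy d' R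
  adequacy (sub d p)  R = ≤D-sound p (adequacy d R)
  adequacy (appE {N = N} {δ = δ} d d') {s} R r S k =
    adequacy d R r (renT id r (apply s N) ∷ S) (⟦⟧ᵈ-rename δ (adequacy d' R) r , k)
  adequacy (lamI {M = M} {δ} {κ} d) = ⟦arr⟧-intro (lam M) body
    where
      body : ∀ {s} → Reducible _ _ s → ∀ S → ⟦ δ ⊠ κ ⟧ᶜ S → sn (apply s (lam M) · S)
      body {s} R (N ∷ S) k = sn-lam-· (⟦⟧ᶜ-candidate (δ ⊠ κ)) (apply (liftᵗ s) M) contractum N S k
        where
          contractum : ∀ N S → ⟦ δ ⊠ κ ⟧ᶜ (N ∷ S) → sn ((apply (liftᵗ s) M [ N /0]) · S)
          contractum N S (dN , kS) =
            subst (λ z → sn (z · S)) (sym (liftᵗ-[/0] N s M))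
                  (⟦arr⟧-· (adequacy d (Reducible-▸ R dN)) kS)
  adequacy (muI {c = c} {κα} d) = ⟦arr⟧-intro (mu c) body
    where
      body : ∀ {s} → Reducible _ _ s → ∀ T → ⟦ κα ⟧ᶜ T → sn (apply s (mu c) · T)
      body {s} R T k =
        sn-mu-· (length T) (⟦⟧ᶜ-candidate κα) (applyᶜ (liftⁿ s) c) contractum T refl k
        where
          contractum : ∀ T → ⟦ κα ⟧ᶜ T → sn (mu (applyᶜ (liftⁿ s) c ⇐⋆ T))
          contractum T k = subst (λ z → sn (mu z)) (sym (liftⁿ-with-⇐⋆ s T [] c))
                                 (sn-mu-command (adequacyᶜ d (Reducible-liftⁿ-with R k)))

  adequacyᶜ : ∀ {Γ Δ c τ} → Γ ⊢rc c ∶ τ ∣ Δ → ∀ {s} → Reducible Γ Δ s →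
              ⟦ τ ⟧ᶜ (command-stack s c)
  adequacyᶜ (cmd {α = α} d) R = adequacy d R , stack-reducible R α
  adequacyᶜ (∧Ic d d')      R = adequacyᶜ d R , adequacyᶜ d' R
  adequacyᶜ (subc d p)      R = ≤C-sound p (adequacyᶜ d R)

theorem6p15 : (Γ : Basis) (Δ : Ctx) (M : Term) (δ : DTy) →
    Γ ⊢r M ∶ δ ∣ Δ → SN M
theorem6p15 Γ Δ M δ d = sn⇒SN (sn-reflect (apply s₀) (apply-⟶ s₀) (⟦⟧ᵈ⇒sn δ (adequacy d R₀)))
  where
    s₀ : GSub
    s₀ = gsub var id (λ α → vars (width (lookupΔ Δ α)))
    R₀ : Reducible Γ Δ s₀
    R₀ = record
      { term-reducible  = λ {x} {δ} _ → ⟦⟧ᵈ-var δ x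
      ; stack-reducible = λ α → ⟦⟧ᶜ-vars (lookupΔ Δ α) ≤-refl
      }
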